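{- Let $P:\{\pm1\}^k\to\{0,1\}$ be a $k$-ary Boolean predicate, and let $\nu$ be a pairwise-uniform distribution over $\{\pm1\}^k$ such that there is a multiset $S\subseteq\{\pm1\}^k$ with $\nu(x)=\Pr_{s\sim S}(s=x)$ for each $x\in\{\pm1\}^k$. Suppose $\mathbb{E}_{x\sim\nu}[P(x)]=\beta>\mathbb{E}_{x\sim\{\pm1\}^k}[P(x)]$ (the latter under the uniform distribution). Then for any constant $\epsilon>0$ there exist an integer $r=O_{\epsilon,k}(|S|^3)$, a rational $\tilde\epsilon\le\epsilon$, and a pairwise-uniform distribution $\theta$ over $\{\pm1\}^{r\times k}$ such that for every $y$ in the support of $\theta$, exactly $(\beta-\tilde\epsilon)r$ of the $r$ rows of $y$ satisfy $P$.
   Context: A distribution on $\{\pm1\}^N$ is pairwise uniform if each coordinate is uniform and each pair of distinct coordinates is uniformly distributed on $\{\pm1\}^2$; for $\theta$ this refers to all $rk$ entries of the matrix.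
   Formalization: The constant ε ranges over the positive rationals. -}

module Defs where

open import Data.Bool using (Bool; true; false)
open import Data.Nat using (ℕ; zero; suc; _*_)
open import Data.Integer using (+_)
open import Data.List using (List; []; _∷_; length; filterᵇ; map; _++_)
open import Data.Fin using (Fin)
open import Data.Vec.Functional using () renaming (_∷_ to _∷ᶠ_)
open import Data.Product using (_×_)
open import Relation.Binary.PropositionalEquality using (_≡_; _≢_)
open import Data.Rational using (ℚ; _/_; 0ℚ)

-- ±1 is encoded as Bool (true = +1, false = -1).

_==_ : Bool → Bool → Bool
true == true = true
false == false = true
_ == _ = false

count : {A : Set} → (A → Bool) → List A → ℕ
count p xs = length (filterᵇ p xs)

-- a / n as a rational (n = 0 gives 0; only used with n ≠ 0)
frac : ℕ → ℕ → ℚ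
frac a zero = 0ℚ
frac a (suc n) = (+ a) / suc n

allPoints : (k : ℕ) → List (Fin k → Bool)
allPoints zero = (λ ()) ∷ []
allPoints (suc k) = map (true ∷ᶠ_) (allPoints k) ++ map (false ∷ᶠ_) (allPoints k)

-- A multiset xs of points of {±1}^I (the distribution "uniform sample from xs")
-- is pairwise uniform: each coordinate is uniform and each pair of distinct
-- coordinates is uniform on {±1}^2.
PairwiseUniform : {I : Set} → List (I → Bool) → Set
PairwiseUniform {I} xs =
  ((p : I) (b : Bool) → 2 * count (λ x → x p == b) xs ≡ length xs)
  × ((p q : I) → p ≢ q → (a b : Bool) →
       4 * count (λ x → (x p == a) Data.Bool.∧ (x q == b)) xs ≡ length xs)

-- Write m = |S|, K = 2^k, s and u for the number of points satisfying P in S and in {±1}^k, so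
-- that D = K s − m u > 0. For an m-tuple W of points, the row multiset repeats each W l f = D t
-- times, adds t m copies of {±1}^k after it if P (W l) holds and t K copies of S otherwise, and
-- finally A more copies of S; each block then has exactly t K s rows satisfying P whatever W is,
-- and the padding is pairwise uniform. θ draws W uniformly and shuffles the r rows by a uniform
-- permutation. Within one row, pairs of coordinates are uniform because both the padding and the
-- entries of W are; across two rows the joint law is governed by the second moments of the column
-- counts of W, which are exactly right when r = m f², and this is what fixes A. Every y in the
-- support then has s (f² − f) satisfying rows out of m f², a fraction β − s / (m f); with d the
-- denominator of ε, forcing d ≤ f ≤ 2 m K d gives s / (m f) ≤ 1 / d ≤ ε and r = O(m³).

module Submission where

open import Defs
open import Data.Bool using (Bool)
open import Data.Nat using (ℕ; suc; _*_; _^_; _≤_; _≥_)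
open import Data.Fin using (Fin)
open import Data.List using (List; length; allFin)
open import Data.Product using (Σ; _×_; _,_)
open import Data.Rational using (ℚ; 0ℚ; _<_; _-_)
open import Relation.Binary.PropositionalEquality using (_≡_; _≢_)
open import Data.List.Relation.Unary.All using (All)
import Data.Rational as Q

open import Data.Bool using (true; false; _∧_; if_then_else_)
open import Data.Bool.Properties using (∧-comm)
import Data.Nat as ℕ
open import Data.Nat using (zero; _+_; _∸_; _!; pred; z≤n; s≤s)
open import Data.Nat.Properties
open import Data.Nat.DivMod using (_/_; _%_; m≡m%n+[m/n]*n; m%n<n)
open import Data.Nat.Tactic.RingSolver using (solve-∀)
import Data.Integer as ℤ
import Data.Integer.Properties as ℤₚ
import Data.Integer.Tactic.RingSolver as ℤSolver
open import Data.Rational using (mkℚ)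
import Data.Rational.Properties as Qₚ
open import Data.Rational.Unnormalised as U using (mkℚᵘ; *≡*; *≤*; *<*)
import Data.Rational.Unnormalised.Properties as Uₚ
open import Data.Fin using (zero; suc; cast; combine)
import Data.Fin.Properties as Finₚ
open import Data.Fin.Properties using () renaming (_≟_ to _≟ᶠ_)
import Data.Fin.Permutation as Perm
import Data.Fin.Permutation.Components as PermComponents
open import Data.List using ([]; _∷_; map; _++_; concatMap; replicate; tabulate; lookup)
open import Data.List.Properties using (length-++; length-map; length-tabulate)
open import Data.List.Relation.Unary.All using ([]; _∷_)
import Data.List.Relation.Unary.All as All
import Data.List.Relation.Unary.All.Properties as Allₚ
open import Data.Vec.Functional using () renaming (_∷_ to _∷ᶠ_)
open import Data.Product using (proj₁; proj₂)
open import Data.Empty using (⊥-elim)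
open import Function using (_∘_; id)
open import Relation.Nullary using (Dec; yes; no)
open import Relation.Binary.PropositionalEquality using (refl; sym; trans; cong; cong₂; subst; subst₂; module ≡-Reasoning)
open import Algebra.Properties.CommutativeSemigroup +-commutativeSemigroup
  using () renaming (interchange to +-interchange)
open import Algebra.Properties.CommutativeSemigroup *-commutativeSemigroup
  using () renaming (x∙yz≈y∙xz to x*[y*z]≡y*[x*z]; x∙yz≈z∙yx to x*[y*z]≡z*[y*x])
open import Algebra.Properties.Semiring.Sum +-*-semiring
  using (sum; sum-syntax; sum-cong-≗; ∑-distrib-+; ∑-comm; sum-permute; *-distribˡ-sum)

-- Finite sums

𝟙 : Bool → ℕ
𝟙 true = 1
𝟙 false = 0

𝟙-∧ : ∀ a b → 𝟙 (a ∧ b) ≡ 𝟙 a * 𝟙 b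
𝟙-∧ true b = sym (+-identityʳ (𝟙 b))
𝟙-∧ false b = refl

𝟙-==-split : ∀ a x → 𝟙 (true == a) * x + 𝟙 (false == a) * x ≡ x
𝟙-==-split true x = trans (cong (_+ 0) (*-identityˡ x)) (+-identityʳ x)
𝟙-==-split false x = *-identityˡ x

𝟙-==-diag : ∀ c a b → 𝟙 (c == a) * 𝟙 (c == b) ≡ 𝟙 (a == b) * 𝟙 (c == a)
𝟙-==-diag true true true = refl
𝟙-==-diag true true false = refl
𝟙-==-diag true false true = refl
𝟙-==-diag true false false = refl
𝟙-==-diag false true true = refl
𝟙-==-diag false true false = refl
𝟙-==-diag false false true = refl
𝟙-==-diag false false false = refl

∑-const : ∀ n c → ∑[ i < n ] c ≡ n * c
∑-const zero c = refl
∑-const (suc n) c = cong (c +_) (∑-const n c)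

∑-cast : ∀ {n n'} (e : n' ≡ n) (g : Fin n → ℕ) → ∑[ i < n' ] g (cast e i) ≡ ∑[ i < n ] g i
∑-cast refl g = sum-cong-≗ (λ i → cong g (Finₚ.cast-is-id refl i))

∑-mul : ∀ n (g h : Fin n → ℕ) → (∑[ i < n ] g i) * (∑[ i < n ] h i) ≡ ∑[ i < n ] ∑[ i' < n ] (g i * h i')
∑-mul n g h = begin
    (∑[ i < n ] g i) * (∑[ i < n ] h i)
  ≡⟨ *-comm (sum g) (sum h) ⟩
    sum h * sum g
  ≡⟨ *-distribˡ-sum (sum h) g ⟩
    ∑[ i < n ] (sum h * g i)
  ≡⟨ sum-cong-≗ (λ i → trans (*-comm (sum h) (g i)) (*-distribˡ-sum (g i) h)) ⟩
    ∑[ i < n ] ∑[ i' < n ] (g i * h i') ∎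
  where open ≡-Reasoning

∑-all-but-one : ∀ n (l : Fin n) (F : Fin n → ℕ) c e → (∀ l' → l' ≢ l → 4 * F l' ≡ c) → 4 * F l ≡ e →
  4 * (∑[ i < n ] F i) + c ≡ n * c + e
∑-all-but-one (suc n) zero F c e others here = begin
    4 * (F zero + sum (F ∘ suc)) + c
  ≡⟨ cong (_+ c) (*-distribˡ-+ 4 (F zero) _) ⟩
    4 * F zero + 4 * sum (F ∘ suc) + c
  ≡⟨ cong₂ (λ x y → x + y + c) here (trans (*-distribˡ-sum 4 (F ∘ suc))
       (trans (sum-cong-≗ (λ l' → others (suc l') λ ())) (∑-const n c))) ⟩
    e + n * c + c
  ≡⟨ regroup e n c ⟩
    suc n * c + e ∎
  where
  open ≡-Reasoning
  regroup : ∀ e n c → e + n * c + c ≡ c + n * c + e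
  regroup = solve-∀
∑-all-but-one (suc n) (suc l) F c e others here = begin
    4 * (F zero + sum (F ∘ suc)) + c
  ≡⟨ trans (cong (_+ c) (*-distribˡ-+ 4 (F zero) _)) (+-assoc (4 * F zero) _ c) ⟩
    4 * F zero + (4 * sum (F ∘ suc) + c)
  ≡⟨ cong₂ _+_ (others zero λ ())
       (∑-all-but-one n l (F ∘ suc) c e (λ l' l'≢l → others (suc l') (l'≢l ∘ Finₚ.suc-injective)) here) ⟩
    c + (n * c + e)
  ≡⟨ +-assoc c (n * c) e ⟨
    suc n * c + e ∎
  where open ≡-Reasoning

infixl 10 ∑ᴸ
∑ᴸ : {A : Set} → List A → (A → ℕ) → ℕ
∑ᴸ [] g = 0
∑ᴸ (x ∷ xs) g = g x + ∑ᴸ xs g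
syntax ∑ᴸ xs (λ x → e) = ∑[ x ← xs ] e

module _ {A : Set} where

  ∑ᴸ-cong : ∀ (xs : List A) {g h : A → ℕ} → (∀ x → g x ≡ h x) → ∑ᴸ xs g ≡ ∑ᴸ xs h
  ∑ᴸ-cong [] e = refl
  ∑ᴸ-cong (x ∷ xs) e = cong₂ _+_ (e x) (∑ᴸ-cong xs e)

  ∑ᴸ-++ : ∀ (xs ys : List A) g → ∑ᴸ (xs ++ ys) g ≡ ∑ᴸ xs g + ∑ᴸ ys g
  ∑ᴸ-++ [] ys g = refl
  ∑ᴸ-++ (x ∷ xs) ys g = trans (cong (g x +_) (∑ᴸ-++ xs ys g)) (sym (+-assoc (g x) _ _))

  ∑ᴸ-distrib-+ : ∀ (xs : List A) g h → ∑[ x ← xs ] (g x + h x) ≡ ∑ᴸ xs g + ∑ᴸ xs h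
  ∑ᴸ-distrib-+ [] g h = refl
  ∑ᴸ-distrib-+ (x ∷ xs) g h = trans (cong (g x + h x +_) (∑ᴸ-distrib-+ xs g h)) (+-interchange (g x) (h x) _ _)

  *-distribˡ-∑ᴸ : ∀ c (xs : List A) g → c * ∑ᴸ xs g ≡ ∑[ x ← xs ] (c * g x)
  *-distribˡ-∑ᴸ c [] g = *-zeroʳ c
  *-distribˡ-∑ᴸ c (x ∷ xs) g = trans (*-distribˡ-+ c (g x) _) (cong (c * g x +_) (*-distribˡ-∑ᴸ c xs g))

  ∑ᴸ-const : ∀ (xs : List A) c → ∑[ _ ← xs ] c ≡ length xs * c
  ∑ᴸ-const [] c = refl
  ∑ᴸ-const (x ∷ xs) c = cong (c +_) (∑ᴸ-const xs c)

  length≡∑ᴸ1 : ∀ (xs : List A) → length xs ≡ ∑[ _ ← xs ] 1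
  length≡∑ᴸ1 xs = sym (trans (∑ᴸ-const xs 1) (*-identityʳ (length xs)))

  ∑ᴸ-∑-comm : ∀ (xs : List A) n (g : A → Fin n → ℕ) → ∑[ x ← xs ] ∑[ i < n ] g x i ≡ ∑[ i < n ] ∑[ x ← xs ] g x i
  ∑ᴸ-∑-comm [] n g = sym (trans (∑-const n 0) (*-zeroʳ n))
  ∑ᴸ-∑-comm (x ∷ xs) n g = trans (cong (sum (g x) +_) (∑ᴸ-∑-comm xs n g)) (sym (∑-distrib-+ (g x) _))

  ∑ᴸ-replicate : ∀ n (x : A) g → ∑ᴸ (replicate n x) g ≡ n * g x
  ∑ᴸ-replicate zero x g = refl
  ∑ᴸ-replicate (suc n) x g = cong (g x +_) (∑ᴸ-replicate n x g)

  ∑ᴸ-lookup : ∀ (xs : List A) g → ∑[ i < length xs ] g (lookup xs i) ≡ ∑ᴸ xs g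
  ∑ᴸ-lookup [] g = refl
  ∑ᴸ-lookup (x ∷ xs) g = cong (g x +_) (∑ᴸ-lookup xs g)

  count≡∑ᴸ : ∀ (p : A → Bool) xs → count p xs ≡ ∑[ x ← xs ] 𝟙 (p x)
  count≡∑ᴸ p [] = refl
  count≡∑ᴸ p (x ∷ xs) with p x
  ... | true = cong suc (count≡∑ᴸ p xs)
  ... | false = count≡∑ᴸ p xs

  count≤length : ∀ (p : A → Bool) xs → count p xs ≤ length xs
  count≤length p [] = z≤n
  count≤length p (x ∷ xs) with p x
  ... | true = s≤s (count≤length p xs)
  ... | false = m≤n⇒m≤1+n (count≤length p xs)

module _ {A B : Set} where

  ∑ᴸ-map : ∀ (f : A → B) xs g → ∑ᴸ (map f xs) g ≡ ∑ᴸ xs (g ∘ f)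
  ∑ᴸ-map f [] g = refl
  ∑ᴸ-map f (x ∷ xs) g = cong (g (f x) +_) (∑ᴸ-map f xs g)

  ∑ᴸ-concatMap : ∀ (f : A → List B) xs g → ∑ᴸ (concatMap f xs) g ≡ ∑[ x ← xs ] ∑ᴸ (f x) g
  ∑ᴸ-concatMap f [] g = refl
  ∑ᴸ-concatMap f (x ∷ xs) g = trans (∑ᴸ-++ (f x) (concatMap f xs) g) (cong (∑ᴸ (f x) g +_) (∑ᴸ-concatMap f xs g))

∑ᴸ-tabulate : ∀ {A : Set} n (f : Fin n → A) g → ∑ᴸ (tabulate f) g ≡ ∑[ i < n ] g (f i)
∑ᴸ-tabulate zero f g = refl
∑ᴸ-tabulate (suc n) f g = cong (g (f zero) +_) (∑ᴸ-tabulate n (f ∘ suc) g)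

∑ᴸ-allFin : ∀ n (g : Fin n → ℕ) → ∑ᴸ (allFin n) g ≡ sum g
∑ᴸ-allFin n g = ∑ᴸ-tabulate n id g

∑ᴸ-𝟙-diag : ∀ {A : Set} (xs : List A) (h : A → Bool) a b →
  ∑[ x ← xs ] (𝟙 (h x == a) * 𝟙 (h x == b)) ≡ 𝟙 (a == b) * ∑[ x ← xs ] 𝟙 (h x == a)
∑ᴸ-𝟙-diag xs h a b = trans (∑ᴸ-cong xs (λ x → 𝟙-==-diag (h x) a b)) (sym (*-distribˡ-∑ᴸ (𝟙 (a == b)) xs _))

∑-𝟙-diag : ∀ n (h : Fin n → Bool) a b →
  ∑[ x < n ] (𝟙 (h x == a) * 𝟙 (h x == b)) ≡ 𝟙 (a == b) * ∑[ x < n ] 𝟙 (h x == a)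
∑-𝟙-diag n h a b =
  trans (sum-cong-≗ {n} (λ x → 𝟙-==-diag (h x) a b)) (sym (*-distribˡ-sum (𝟙 (a == b)) (λ x → 𝟙 (h x == a))))

-- Pairwise uniform multisets

module _ {A : Set} where

  count-++ : ∀ (p : A → Bool) xs ys → count p (xs ++ ys) ≡ count p xs + count p ys
  count-++ p xs ys = trans (count≡∑ᴸ p (xs ++ ys))
    (trans (∑ᴸ-++ xs ys _) (sym (cong₂ _+_ (count≡∑ᴸ p xs) (count≡∑ᴸ p ys))))

  Balanced : ℕ → (A → Bool) → List A → Set
  Balanced c p xs = c * count p xs ≡ length xs

  Balanced-++ : ∀ c p xs ys → Balanced c p xs → Balanced c p ys → Balanced c p (xs ++ ys)
  Balanced-++ c p xs ys bx by = begin
      c * count p (xs ++ ys)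
    ≡⟨ cong (c *_) (count-++ p xs ys) ⟩
      c * (count p xs + count p ys)
    ≡⟨ *-distribˡ-+ c (count p xs) _ ⟩
      c * count p xs + c * count p ys
    ≡⟨ cong₂ _+_ bx by ⟩
      length xs + length ys
    ≡⟨ length-++ xs ⟨
      length (xs ++ ys) ∎
    where open ≡-Reasoning

  copies : ℕ → List A → List A
  copies zero xs = []
  copies (suc c) xs = xs ++ copies c xs

  Balanced-copies : ∀ c p n xs → Balanced c p xs → Balanced c p (copies n xs)
  Balanced-copies c p zero xs b = *-zeroʳ c
  Balanced-copies c p (suc n) xs b = Balanced-++ c p xs (copies n xs) b (Balanced-copies c p n xs b)

  ∑ᴸ-copies : ∀ n xs g → ∑ᴸ (copies n xs) g ≡ n * ∑ᴸ xs g
  ∑ᴸ-copies zero xs g = refl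
  ∑ᴸ-copies (suc n) xs g = trans (∑ᴸ-++ xs (copies n xs) g) (cong (∑ᴸ xs g +_) (∑ᴸ-copies n xs g))

  length-copies : ∀ n xs → length (copies n xs) ≡ n * length xs
  length-copies n xs = trans (length≡∑ᴸ1 (copies n xs))
    (trans (∑ᴸ-copies n xs _) (cong (n *_) (sym (length≡∑ᴸ1 xs))))

module _ {A B : Set} where

  Balanced-concatMap : ∀ c p (h : B → List A) bs → (∀ b → Balanced c p (h b)) → Balanced c p (concatMap h bs)
  Balanced-concatMap c p h [] hb = *-zeroʳ c
  Balanced-concatMap c p h (b ∷ bs) hb = Balanced-++ c p (h b) (concatMap h bs) (hb b) (Balanced-concatMap c p h bs hb)

module _ {I : Set} where

  PairwiseUniform-++ : ∀ (xs ys : List (I → Bool)) → PairwiseUniform xs → PairwiseUniform ys → PairwiseUniform (xs ++ ys)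
  PairwiseUniform-++ xs ys (x₁ , x₂) (y₁ , y₂) =
    (λ p b → Balanced-++ 2 (λ x → x p == b) xs ys (x₁ p b) (y₁ p b)) ,
    (λ p q p≢q a b → Balanced-++ 4 (λ x → (x p == a) ∧ (x q == b)) xs ys (x₂ p q p≢q a b) (y₂ p q p≢q a b))

  PairwiseUniform-copies : ∀ n (xs : List (I → Bool)) → PairwiseUniform xs → PairwiseUniform (copies n xs)
  PairwiseUniform-copies n xs (x₁ , x₂) =
    (λ p b → Balanced-copies 2 (λ x → x p == b) n xs (x₁ p b)) ,
    (λ p q p≢q a b → Balanced-copies 4 (λ x → (x p == a) ∧ (x q == b)) n xs (x₂ p q p≢q a b))

  PairwiseUniform-concatMap : ∀ {B : Set} (h : B → List (I → Bool)) bs → (∀ b → PairwiseUniform (h b)) →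
    PairwiseUniform (concatMap h bs)
  PairwiseUniform-concatMap h bs hb =
    (λ p b → Balanced-concatMap 2 (λ x → x p == b) h bs (λ b' → proj₁ (hb b') p b)) ,
    (λ p q p≢q a b → Balanced-concatMap 4 (λ x → (x p == a) ∧ (x q == b)) h bs (λ b' → proj₂ (hb b') p q p≢q a b))

module _ {A : Set} where

  count-cong : ∀ {p q : A → Bool} xs → (∀ x → p x ≡ q x) → count p xs ≡ count q xs
  count-cong {p} {q} xs e = trans (count≡∑ᴸ p xs) (trans (∑ᴸ-cong xs (cong 𝟙 ∘ e)) (sym (count≡∑ᴸ q xs)))

  count-const : ∀ c (xs : List A) → count (λ _ → c) xs ≡ 𝟙 c * length xs
  count-const c xs = trans (count≡∑ᴸ _ xs) (trans (∑ᴸ-const xs (𝟙 c)) (*-comm (length xs) (𝟙 c)))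

  count-∧ˡ : ∀ c (p : A → Bool) xs → count (λ x → c ∧ p x) xs ≡ 𝟙 c * count p xs
  count-∧ˡ true p xs = sym (+-identityʳ (count p xs))
  count-∧ˡ false p xs = count-const false xs

  count-map : ∀ {B : Set} (p : B → Bool) (f : A → B) xs → count p (map f xs) ≡ count (p ∘ f) xs
  count-map p f xs = trans (count≡∑ᴸ p (map f xs)) (trans (∑ᴸ-map f xs _) (sym (count≡∑ᴸ (p ∘ f) xs)))

count-allPoints-suc : ∀ n (p : (Fin (suc n) → Bool) → Bool) →
  count p (allPoints (suc n)) ≡ count (λ x → p (true ∷ᶠ x)) (allPoints n) + count (λ x → p (false ∷ᶠ x)) (allPoints n)
count-allPoints-suc n p = trans (count-++ p (map (true ∷ᶠ_) (allPoints n)) _)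
  (cong₂ _+_ (count-map p (true ∷ᶠ_) (allPoints n)) (count-map p (false ∷ᶠ_) (allPoints n)))

length-allPoints-suc : ∀ n → length (allPoints (suc n)) ≡ length (allPoints n) + length (allPoints n)
length-allPoints-suc n = trans (length-++ (map (true ∷ᶠ_) (allPoints n)))
  (cong₂ _+_ (length-map (true ∷ᶠ_) (allPoints n)) (length-map (false ∷ᶠ_) (allPoints n)))

length-allPoints : ∀ n → length (allPoints n) ≡ 2 ^ n
length-allPoints zero = refl
length-allPoints (suc n) = trans (length-allPoints-suc n)
  (trans (cong₂ _+_ (length-allPoints n) (length-allPoints n)) (cong (2 ^ n +_) (sym (+-identityʳ (2 ^ n)))))

private
  doubled : ∀ c x l → c * x ≡ l → c * (x + x) ≡ l + l
  doubled c x l e = trans (*-distribˡ-+ c x x) (cong₂ _+_ e e)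

  split-halves : ∀ c a x l → c * x ≡ l → c * (𝟙 (true == a) * x + 𝟙 (false == a) * x) ≡ l
  split-halves c a x l e = trans (cong (c *_) (𝟙-==-split a x)) e

  quartered : ∀ x l → 2 * x ≡ l → 4 * x ≡ l + l
  quartered x l e = trans (*-distribʳ-+ x 2 2) (cong₂ _+_ e e)

allPoints-coordinates : ∀ n p b → Balanced 2 (λ x → x p == b) (allPoints n)
allPoints-coordinates (suc n) zero b = begin
    2 * count (λ x → x zero == b) (allPoints (suc n))
  ≡⟨ cong (2 *_) (trans (count-allPoints-suc n _) (cong₂ _+_ (count-const (true == b) Ps) (count-const (false == b) Ps))) ⟩
    2 * (𝟙 (true == b) * L + 𝟙 (false == b) * L)
  ≡⟨ split-halves 2 b L (L + L) (trans (*-distribʳ-+ L 1 1) (cong₂ _+_ (*-identityˡ L) (*-identityˡ L))) ⟩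
    L + L
  ≡⟨ length-allPoints-suc n ⟨
    length (allPoints (suc n)) ∎
  where
  open ≡-Reasoning
  Ps = allPoints n
  L = length Ps
allPoints-coordinates (suc n) (suc p) b =
  trans (cong (2 *_) (count-allPoints-suc n _))
    (trans (doubled 2 (count (λ x → x p == b) (allPoints n)) _ (allPoints-coordinates n p b)) (sym (length-allPoints-suc n)))

allPoints-pairs : ∀ n p q → p ≢ q → ∀ a b → Balanced 4 (λ x → (x p == a) ∧ (x q == b)) (allPoints n)
allPoints-pairs (suc n) zero zero p≢q a b = ⊥-elim (p≢q refl)
allPoints-pairs (suc n) zero (suc q) _ a b =
  trans (cong (4 *_) (trans (count-allPoints-suc n _)
    (cong₂ _+_ (count-∧ˡ (true == a) (λ x → x q == b) Ps) (count-∧ˡ (false == a) (λ x → x q == b) Ps))))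
    (trans (split-halves 4 a C _ (quartered C _ (allPoints-coordinates n q b))) (sym (length-allPoints-suc n)))
  where
  Ps = allPoints n
  C = count (λ x → x q == b) Ps
allPoints-pairs (suc n) (suc p) zero p≢q a b =
  trans (cong (4 *_) (count-cong (allPoints (suc n)) (λ x → ∧-comm (x (suc p) == a) (x zero == b))))
    (allPoints-pairs (suc n) zero (suc p) (p≢q ∘ sym) b a)
allPoints-pairs (suc n) (suc p) (suc q) p≢q a b =
  trans (cong (4 *_) (count-allPoints-suc n _))
    (trans (doubled 4 (count (λ x → (x p == a) ∧ (x q == b)) (allPoints n)) _ (allPoints-pairs n p q (p≢q ∘ cong suc) a b))
      (sym (length-allPoints-suc n)))

allPoints-pairwiseUniform : ∀ n → PairwiseUniform (allPoints n)
allPoints-pairwiseUniform n = allPoints-coordinates n , allPoints-pairs n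

-- Averaging over all permutations

swap₀ : ∀ {n} → Fin (suc n) → Fin (suc n) → Fin (suc n)
swap₀ t = PermComponents.transpose zero t

lift₀ : ∀ {n} → (Fin n → Fin n) → Fin (suc n) → Fin (suc n)
lift₀ σ zero = zero
lift₀ σ (suc i) = suc (σ i)

-- Each permutation of Fin (suc n) is swap₀ (σ zero) ∘ lift₀ τ for exactly one permutation τ of Fin n.
permutations : ∀ n → List (Fin n → Fin n)
permutations zero = id ∷ []
permutations (suc n) = concatMap (λ t → map (λ σ → swap₀ t ∘ lift₀ σ) (permutations n)) (allFin (suc n))

∑-swap₀ : ∀ n t (g : Fin (suc n) → ℕ) → ∑[ i < suc n ] g (swap₀ t i) ≡ sum g
∑-swap₀ n t g = sym (sum-permute g (Perm.transpose zero t))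

∑-swap₀-suc : ∀ n t (g : Fin (suc n) → ℕ) → ∑[ i < n ] g (swap₀ t (suc i)) + g t ≡ sum g
∑-swap₀-suc n t g = trans (+-comm _ (g t)) (∑-swap₀ n t g)

∑-∑-swap₀-suc : ∀ n (g : Fin (suc n) → ℕ) → ∑[ t < suc n ] ∑[ i < n ] g (swap₀ t (suc i)) + sum g ≡ suc n * sum g
∑-∑-swap₀-suc n g = trans (sym (∑-distrib-+ (λ t → ∑[ i < n ] g (swap₀ t (suc i))) g))
  (trans (sum-cong-≗ (λ t → ∑-swap₀-suc n t g)) (∑-const (suc n) (sum g)))

∑ᴸ-permutations-suc : ∀ n (G : (Fin (suc n) → Fin (suc n)) → ℕ) →
  ∑ᴸ (permutations (suc n)) G ≡ ∑[ t < suc n ] ∑[ σ ← permutations n ] G (swap₀ t ∘ lift₀ σ)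
∑ᴸ-permutations-suc n G =
  trans (∑ᴸ-concatMap (λ t → map (λ σ → swap₀ t ∘ lift₀ σ) (permutations n)) (allFin (suc n)) G)
    (trans (∑ᴸ-cong (allFin (suc n)) (λ t → ∑ᴸ-map (λ σ → swap₀ t ∘ lift₀ σ) (permutations n) G)) (∑ᴸ-allFin (suc n) _))

length-permutations : ∀ n → length (permutations n) ≡ n !
length-permutations zero = refl
length-permutations (suc n) = trans (length≡∑ᴸ1 (permutations (suc n))) (trans (∑ᴸ-permutations-suc n (λ _ → 1))
  (trans (sum-cong-≗ {suc n} (λ _ → sym (length≡∑ᴸ1 (permutations n))))
  (trans (∑-const (suc n) _) (cong (suc n *_) (length-permutations n)))))

permutations-preserve-∑ : ∀ n → All (λ σ → ∀ g → ∑[ i < n ] g (σ i) ≡ sum g) (permutations n)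
permutations-preserve-∑ zero = (λ g → refl) ∷ []
permutations-preserve-∑ (suc n) = Allₚ.concat⁺ (Allₚ.map⁺ (Allₚ.tabulate⁺ λ t → Allₚ.map⁺ (All.map
  (λ σ-preserves g → trans (cong (g t +_) (σ-preserves (λ i → g (swap₀ t (suc i))))) (∑-swap₀ n t g))
  (permutations-preserve-∑ n))))

∑ᴸ-permutations-lookup : ∀ n i (g : Fin (suc n) → ℕ) → ∑[ σ ← permutations (suc n) ] g (σ i) ≡ n ! * sum g
∑ᴸ-permutations-lookup n zero g = trans (∑ᴸ-permutations-suc n _)
  (trans (sum-cong-≗ (λ t → trans (∑ᴸ-const (permutations n) (g t)) (cong (_* g t) (length-permutations n))))
  (sym (*-distribˡ-sum (n !) g)))
∑ᴸ-permutations-lookup (suc n) (suc i) g = begin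
    ∑[ σ ← permutations (suc (suc n)) ] g (σ (suc i))
  ≡⟨ ∑ᴸ-permutations-suc (suc n) _ ⟩
    ∑[ t < suc (suc n) ] ∑[ σ ← permutations (suc n) ] g (swap₀ t (suc (σ i)))
  ≡⟨ sum-cong-≗ (λ t → ∑ᴸ-permutations-lookup n i (g ∘ swap₀ t ∘ suc)) ⟩
    ∑[ t < suc (suc n) ] (n ! * ∑[ x < suc n ] g (swap₀ t (suc x)))
  ≡⟨ *-distribˡ-sum (n !) (λ t → ∑[ x < suc n ] g (swap₀ t (suc x))) ⟨
    n ! * ∑[ t < suc (suc n) ] ∑[ x < suc n ] g (swap₀ t (suc x))
  ≡⟨ cong (n ! *_) (+-cancelʳ-≡ (sum g) _ _ (trans (∑-∑-swap₀-suc (suc n) g) (+-comm (sum g) (suc n * sum g)))) ⟩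
    n ! * (suc n * sum g)
  ≡⟨ *-assoc (n !) (suc n) (sum g) ⟨
    n ! * suc n * sum g
  ≡⟨ cong (_* sum g) (*-comm (n !) (suc n)) ⟩
    suc n ! * sum g ∎
  where open ≡-Reasoning

∑-∑∑-swap₀-suc : ∀ n (g : Fin (suc n) → Fin (suc n) → ℕ) →
  ∑[ t < suc n ] ∑[ x < n ] ∑[ y < n ] g (swap₀ t (suc x)) (swap₀ t (suc y)) + 2 * ∑[ x < suc n ] ∑[ y < suc n ] g x y
    ≡ suc n * ∑[ x < suc n ] ∑[ y < suc n ] g x y + ∑[ x < suc n ] g x x
∑-∑∑-swap₀-suc n g = begin
    ∑[ t < N ] Inner t + 2 * T
  ≡⟨ cong (sum Inner +_) (trans (cong (T +_) (+-identityʳ T)) (cong (_+ T) (∑-comm g))) ⟩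
    ∑[ t < N ] Inner t + (∑[ y < N ] Col y + ∑[ x < N ] Row x)
  ≡⟨ trans (sym (+-assoc (sum Inner) (sum Col) (sum Row))) (cong (_+ sum Row) (sym (∑-distrib-+ Inner Col))) ⟩
    ∑[ t < N ] (Inner t + Col t) + ∑[ x < N ] Row x
  ≡⟨ sym (∑-distrib-+ (λ t → Inner t + Col t) Row) ⟩
    ∑[ t < N ] (Inner t + Col t + Row t)
  ≡⟨ sum-cong-≗ without-row-and-column ⟩
    ∑[ t < N ] (T + g t t)
  ≡⟨ trans (∑-distrib-+ (λ _ → T) (λ t → g t t)) (cong (_+ sum (λ t → g t t)) (∑-const N T)) ⟩
    N * T + ∑[ x < N ] g x x ∎
  where
  open ≡-Reasoning
  N = suc n
  T = ∑[ x < N ] ∑[ y < N ] g x y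
  Row = λ x → ∑[ y < N ] g x y
  Col = λ y → ∑[ x < N ] g x y
  Inner = λ t → ∑[ x < n ] ∑[ y < n ] g (swap₀ t (suc x)) (swap₀ t (suc y))
  without-row-and-column : ∀ t → Inner t + Col t + Row t ≡ T + g t t
  without-row-and-column t = begin
      Inner t + Col t + Row t
    ≡⟨ cong (λ c → Inner t + c + Row t) (sym (∑-swap₀-suc n t (λ x → g x t))) ⟩
      Inner t + (ColRest + g t t) + Row t
    ≡⟨ regroup (Inner t) ColRest (g t t) (Row t) ⟩
      (Inner t + ColRest) + Row t + g t t
    ≡⟨ cong (λ z → z + Row t + g t t) (trans (sym (∑-distrib-+ _ (λ x → g (swap₀ t (suc x)) t)))
         (sum-cong-≗ (λ x → ∑-swap₀-suc n t (g (swap₀ t (suc x)))))) ⟩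
      ∑[ x < n ] Row (swap₀ t (suc x)) + Row t + g t t
    ≡⟨ cong (_+ g t t) (∑-swap₀-suc n t Row) ⟩
      T + g t t ∎
    where
    ColRest = ∑[ x < n ] g (swap₀ t (suc x)) t
    regroup : ∀ a b c d → a + (b + c) + d ≡ a + b + d + c
    regroup = solve-∀

private
  lookup₂-zero : ∀ n i (g : Fin (suc (suc n)) → Fin (suc (suc n)) → ℕ) →
    ∑[ σ ← permutations (suc (suc n)) ] g (σ zero) (σ (suc i)) + n ! * ∑[ x < suc (suc n) ] g x x
      ≡ n ! * ∑[ x < suc (suc n) ] ∑[ y < suc (suc n) ] g x y
  lookup₂-zero n i g = begin
      ∑[ σ ← permutations N ] g (σ zero) (σ (suc i)) + n ! * D
    ≡⟨ cong (_+ n ! * D) (trans (∑ᴸ-permutations-suc (suc n) _)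
         (sum-cong-≗ (λ t → ∑ᴸ-permutations-lookup n i (λ x → g t (swap₀ t (suc x)))))) ⟩
      ∑[ t < N ] (n ! * Rest t) + n ! * D
    ≡⟨ cong (_+ n ! * D) (*-distribˡ-sum (n !) Rest) ⟨
      n ! * ∑[ t < N ] Rest t + n ! * D
    ≡⟨ *-distribˡ-+ (n !) (sum Rest) D ⟨
      n ! * (∑[ t < N ] Rest t + D)
    ≡⟨ cong (n ! *_) (trans (sym (∑-distrib-+ Rest (λ x → g x x))) (sum-cong-≗ (λ t → ∑-swap₀-suc (suc n) t (g t)))) ⟩
      n ! * ∑[ x < N ] ∑[ y < N ] g x y ∎
    where
    open ≡-Reasoning
    N = suc (suc n)
    D = ∑[ x < N ] g x x
    Rest = λ t → ∑[ x < suc n ] g t (swap₀ t (suc x))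

  eliminate : ∀ X SD ST D T a c → X + a * SD ≡ a * ST → SD + D ≡ (2 + c) * D → ST + 2 * T ≡ (2 + c) * T + D →
    X + (c * a) * D ≡ (c * a) * T
  eliminate X SD ST D T a c e₁ e₂ e₃ =
    +-cancelʳ-≡ (a * D) _ _ (trans (lhs X a c D) (trans (cong (λ z → X + a * z) (sym SD≡))
      (trans e₁ (trans (cong (a *_) ST≡) (rhs a c T D)))))
    where
    SD≡ : SD ≡ suc c * D
    SD≡ = +-cancelʳ-≡ D SD (suc c * D) (trans e₂ (split c D))
      where split : ∀ c D → (2 + c) * D ≡ suc c * D + D
            split = solve-∀
    ST≡ : ST ≡ c * T + D
    ST≡ = +-cancelʳ-≡ (2 * T) ST (c * T + D) (trans e₃ (split c T D))
      where split : ∀ c T D → (2 + c) * T + D ≡ c * T + D + 2 * T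
            split = solve-∀
    lhs : ∀ X a c D → X + c * a * D + a * D ≡ X + a * (suc c * D)
    lhs = solve-∀
    rhs : ∀ a c T D → a * (c * T + D) ≡ c * a * T + a * D
    rhs = solve-∀

∑ᴸ-permutations-lookup₂ : ∀ n (i i' : Fin (suc (suc n))) → i ≢ i' → (g : Fin (suc (suc n)) → Fin (suc (suc n)) → ℕ) →
  ∑[ σ ← permutations (suc (suc n)) ] g (σ i) (σ i') + n ! * ∑[ x < suc (suc n) ] g x x
    ≡ n ! * ∑[ x < suc (suc n) ] ∑[ y < suc (suc n) ] g x y
∑ᴸ-permutations-lookup₂ n zero zero i≢i' g = ⊥-elim (i≢i' refl)
∑ᴸ-permutations-lookup₂ n zero (suc i') _ g = lookup₂-zero n i' g
∑ᴸ-permutations-lookup₂ n (suc i) zero _ g = trans (lookup₂-zero n i (λ x y → g y x)) (cong (n ! *_) (∑-comm (λ x y → g y x)))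
∑ᴸ-permutations-lookup₂ zero (suc zero) (suc zero) i≢i' g = ⊥-elim (i≢i' refl)
∑ᴸ-permutations-lookup₂ (suc n) (suc i) (suc i') i≢i' g =
  eliminate (∑[ σ ← permutations N ] g (σ (suc i)) (σ (suc i'))) (sum Diag) (sum Total) D T (n !) (suc n)
    summed-induction-hypothesis (∑-∑-swap₀-suc (suc (suc n)) (λ x → g x x)) (∑-∑∑-swap₀-suc (suc (suc n)) g)
  where
  N = suc (suc (suc n))
  D = ∑[ x < N ] g x x
  T = ∑[ x < N ] ∑[ y < N ] g x y
  h : Fin N → Fin (suc (suc n)) → Fin (suc (suc n)) → ℕ
  h t x y = g (swap₀ t (suc x)) (swap₀ t (suc y))
  Diag = λ t → ∑[ x < suc (suc n) ] h t x x
  Total = λ t → ∑[ x < suc (suc n) ] ∑[ y < suc (suc n) ] h t x y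
  summed-induction-hypothesis : ∑[ σ ← permutations N ] g (σ (suc i)) (σ (suc i')) + n ! * sum Diag ≡ n ! * sum Total
  summed-induction-hypothesis = begin
      ∑[ σ ← permutations N ] g (σ (suc i)) (σ (suc i')) + n ! * sum Diag
    ≡⟨ cong₂ _+_ (∑ᴸ-permutations-suc (suc (suc n)) _) (*-distribˡ-sum (n !) Diag) ⟩
      ∑[ t < N ] ∑[ σ ← permutations (suc (suc n)) ] h t (σ i) (σ i') + ∑[ t < N ] (n ! * Diag t)
    ≡⟨ ∑-distrib-+ (λ t → ∑[ σ ← permutations (suc (suc n)) ] h t (σ i) (σ i')) (λ t → n ! * Diag t) ⟨
      ∑[ t < N ] (∑[ σ ← permutations (suc (suc n)) ] h t (σ i) (σ i') + n ! * Diag t)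
    ≡⟨ sum-cong-≗ (λ t → ∑ᴸ-permutations-lookup₂ n i i' (i≢i' ∘ cong suc) (h t)) ⟩
      ∑[ t < N ] (n ! * Total t)
    ≡⟨ *-distribˡ-sum (n !) Total ⟨
      n ! * sum Total ∎
    where open ≡-Reasoning

∑ᴸ-permutations-lookup-scaled : ∀ n (i : Fin n) (g : Fin n → ℕ) → n * ∑[ σ ← permutations n ] g (σ i) ≡ n ! * sum g
∑ᴸ-permutations-lookup-scaled (suc n) i g =
  trans (cong (suc n *_) (∑ᴸ-permutations-lookup n i g)) (sym (*-assoc (suc n) (n !) (sum g)))

∑ᴸ-permutations-lookup₂-scaled : ∀ n (i i' : Fin n) → i ≢ i' → (g : Fin n → Fin n → ℕ) →
  n * pred n * ∑[ σ ← permutations n ] g (σ i) (σ i') + n ! * ∑[ x < n ] g x x ≡ n ! * ∑[ x < n ] ∑[ y < n ] g x y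
∑ᴸ-permutations-lookup₂-scaled (suc zero) zero zero i≢i' g = ⊥-elim (i≢i' refl)
∑ᴸ-permutations-lookup₂-scaled (suc (suc n)) i i' i≢i' g = begin
    N * suc n * X + N * (suc n * n !) * D
  ≡⟨ cong (N * suc n * X +_) (reassoc N (suc n) (n !) D) ⟩
    N * suc n * X + N * suc n * (n ! * D)
  ≡⟨ *-distribˡ-+ (N * suc n) X (n ! * D) ⟨
    N * suc n * (X + n ! * D)
  ≡⟨ cong (N * suc n *_) (∑ᴸ-permutations-lookup₂ n i i' i≢i' g) ⟩
    N * suc n * (n ! * T)
  ≡⟨ reassoc N (suc n) (n !) T ⟨
    N * (suc n * n !) * T ∎
  where
  open ≡-Reasoning
  N = suc (suc n)
  X = ∑[ σ ← permutations N ] g (σ i) (σ i')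
  D = ∑[ x < N ] g x x
  T = ∑[ x < N ] ∑[ y < N ] g x y
  reassoc : ∀ a b c d → a * (b * c) * d ≡ a * b * (c * d)
  reassoc = solve-∀

private
  *-cancelˡ-Fin : ∀ {n} → Fin n → ∀ x y → n * x ≡ n * y → x ≡ y
  *-cancelˡ-Fin {suc n} _ x y = *-cancelˡ-≡ x y (suc n)

  pair-count-from-moments : ∀ {n} (i i' : Fin n) → i ≢ i' → ∀ C Ds Ts N F →
    n * pred n * C + F * Ds ≡ F * Ts → 4 * Ts + N * n ≡ N * (n * n) + 4 * Ds → 4 * C ≡ N * F
  pair-count-from-moments {suc zero} zero zero i≢i' = ⊥-elim (i≢i' refl)
  pair-count-from-moments {suc (suc m)} _ _ _ C Ds Ts N F perm-identity moment-identity =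
    *-cancelˡ-≡ (4 * C) (N * F) q (+-cancelʳ-≡ (F * N * n) _ _ (+-cancelʳ-≡ (F * (4 * Ds)) _ _ (begin
        q * (4 * C) + F * N * n + F * (4 * Ds)
      ≡⟨ regroup₁ q C F Ds N n ⟩
        4 * (q * C + F * Ds) + F * N * n
      ≡⟨ cong (λ z → 4 * z + F * N * n) perm-identity ⟩
        4 * (F * Ts) + F * N * n
      ≡⟨ regroup₂ F Ts N n ⟩
        F * (4 * Ts + N * n)
      ≡⟨ cong (F *_) moment-identity ⟩
        F * (N * (n * n) + 4 * Ds)
      ≡⟨ regroup₃ F N m Ds ⟩
        q * (N * F) + F * N * n + F * (4 * Ds) ∎)))
    where
    open ≡-Reasoning
    n = suc (suc m)
    q = n * suc m
    regroup₁ : ∀ q C F Ds N n → q * (4 * C) + F * N * n + F * (4 * Ds) ≡ 4 * (q * C + F * Ds) + F * N * n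
    regroup₁ = solve-∀
    regroup₂ : ∀ F Ts N n → 4 * (F * Ts) + F * N * n ≡ F * (4 * Ts + N * n)
    regroup₂ = solve-∀
    regroup₃ : ∀ F N m Ds → F * (N * ((2 + m) * (2 + m)) + 4 * Ds) ≡ (2 + m) * (1 + m) * (N * F) + F * N * (2 + m) + F * (4 * Ds)
    regroup₃ = solve-∀

-- Shuffling rows

module Symmetrization {V : Set} (vs : List V) (r k : ℕ) (R : V → Fin r → Fin k → Bool) where

  shuffle : V → (Fin r → Fin r) → Fin r × Fin k → Bool
  shuffle v σ (i , j) = R v (σ i) j

  shuffles : List (Fin r × Fin k → Bool)
  shuffles = concatMap (λ v → map (shuffle v) (permutations r)) vs

  ones : V → Fin k → Bool → ℕ
  ones v j a = ∑[ x < r ] 𝟙 (R v x j == a)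

  both : V → Fin k → Bool → Fin k → Bool → ℕ
  both v j a j' b = ∑[ x < r ] (𝟙 (R v x j == a) * 𝟙 (R v x j' == b))

  -- For rows i ≢ i', a uniform permutation sends (i, i') to a uniform pair of distinct rows, so the
  -- count of (a, b) at ((i, j), (i', j')) is proportional to ones · ones − both; uniformity of that
  -- count is this identity.
  SecondMoment : Fin k → Bool → Fin k → Bool → Set
  SecondMoment j a j' b =
    4 * ∑[ v ← vs ] (ones v j a * ones v j' b) + length vs * r ≡ length vs * (r * r) + 4 * ∑[ v ← vs ] both v j a j' b

  ∑ᴸ-shuffles : ∀ G → ∑ᴸ shuffles G ≡ ∑[ v ← vs ] ∑[ σ ← permutations r ] G (shuffle v σ)
  ∑ᴸ-shuffles G = trans (∑ᴸ-concatMap (λ v → map (shuffle v) (permutations r)) vs G)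
    (∑ᴸ-cong vs (λ v → ∑ᴸ-map (shuffle v) (permutations r) G))

  length-shuffles : length shuffles ≡ length vs * r !
  length-shuffles = trans (length≡∑ᴸ1 shuffles) (trans (∑ᴸ-shuffles (λ _ → 1))
    (trans (∑ᴸ-cong vs (λ _ → trans (sym (length≡∑ᴸ1 (permutations r))) (length-permutations r))) (∑ᴸ-const vs (r !))))

  private
    same-row : ∀ (i : Fin r) c (g : (Fin k → Bool) → ℕ) → c * ∑[ v ← vs ] ∑[ x < r ] g (R v x) ≡ length vs * r →
      c * ∑[ y ← shuffles ] g (λ j → y (i , j)) ≡ length vs * r !
    same-row i c g moment = *-cancelˡ-Fin i _ _ (begin
        r * (c * ∑[ y ← shuffles ] g (λ j → y (i , j)))
      ≡⟨ cong (λ z → r * (c * z)) (∑ᴸ-shuffles _) ⟩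
        r * (c * ∑[ v ← vs ] ∑[ σ ← permutations r ] g (R v (σ i)))
      ≡⟨ x*[y*z]≡y*[x*z] r c _ ⟩
        c * (r * ∑[ v ← vs ] ∑[ σ ← permutations r ] g (R v (σ i)))
      ≡⟨ cong (c *_) (trans (*-distribˡ-∑ᴸ r vs _) (∑ᴸ-cong vs (λ v → ∑ᴸ-permutations-lookup-scaled r i (g ∘ R v)))) ⟩
        c * ∑[ v ← vs ] (r ! * ∑[ x < r ] g (R v x))
      ≡⟨ cong (c *_) (*-distribˡ-∑ᴸ (r !) vs _) ⟨
        c * (r ! * ∑[ v ← vs ] ∑[ x < r ] g (R v x))
      ≡⟨ x*[y*z]≡y*[x*z] c (r !) _ ⟩
        r ! * (c * ∑[ v ← vs ] ∑[ x < r ] g (R v x))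
      ≡⟨ cong (r ! *_) moment ⟩
        r ! * (length vs * r)
      ≡⟨ x*[y*z]≡z*[y*x] (r !) (length vs) r ⟩
        r * (length vs * r !) ∎)
      where open ≡-Reasoning

    different-rows : ∀ (i i' : Fin r) → i ≢ i' → ∀ j a j' b → SecondMoment j a j' b →
      4 * ∑[ y ← shuffles ] (𝟙 (y (i , j) == a) * 𝟙 (y (i' , j') == b)) ≡ length vs * r !
    different-rows i i' i≢i' j a j' b moment =
      pair-count-from-moments i i' i≢i' _ (∑[ v ← vs ] both v j a j' b) _ (length vs) (r !) (begin
          r * pred r * ∑[ y ← shuffles ] G y + r ! * ∑[ v ← vs ] both v j a j' b
        ≡⟨ cong₂ _+_ (trans (cong (r * pred r *_) (∑ᴸ-shuffles G)) (*-distribˡ-∑ᴸ (r * pred r) vs _)) (*-distribˡ-∑ᴸ (r !) vs _) ⟩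
          ∑[ v ← vs ] (r * pred r * ∑[ σ ← permutations r ] g v (σ i) (σ i')) + ∑[ v ← vs ] (r ! * both v j a j' b)
        ≡⟨ ∑ᴸ-distrib-+ vs _ _ ⟨
          ∑[ v ← vs ] (r * pred r * ∑[ σ ← permutations r ] g v (σ i) (σ i') + r ! * both v j a j' b)
        ≡⟨ ∑ᴸ-cong vs (λ v → trans (∑ᴸ-permutations-lookup₂-scaled r i i' i≢i' (g v))
             (cong (r ! *_) (sym (∑-mul r (λ x → 𝟙 (R v x j == a)) (λ y → 𝟙 (R v y j' == b)))))) ⟩
          ∑[ v ← vs ] (r ! * (ones v j a * ones v j' b))
        ≡⟨ *-distribˡ-∑ᴸ (r !) vs _ ⟨
          r ! * ∑[ v ← vs ] (ones v j a * ones v j' b) ∎) moment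
      where
      open ≡-Reasoning
      G : (Fin r × Fin k → Bool) → ℕ
      G y = 𝟙 (y (i , j) == a) * 𝟙 (y (i' , j') == b)
      g : V → Fin r → Fin r → ℕ
      g v x y = 𝟙 (R v x j == a) * 𝟙 (R v y j' == b)

  shuffles-pairwiseUniform :
    (∀ j a → 2 * ∑[ v ← vs ] ones v j a ≡ length vs * r) →
    (∀ j j' → j ≢ j' → ∀ a b → 4 * ∑[ v ← vs ] both v j a j' b ≡ length vs * r) →
    (∀ j a j' b → SecondMoment j a j' b) →
    PairwiseUniform shuffles
  shuffles-pairwiseUniform first-moment pair-moment second-moment = coordinates , pairs
    where
    coordinates : ∀ p b → Balanced 2 (λ y → y p == b) shuffles
    coordinates (i , j) a = trans (cong (2 *_) (count≡∑ᴸ _ shuffles))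
      (trans (same-row i 2 (λ p → 𝟙 (p j == a)) (first-moment j a)) (sym length-shuffles))
    pairs : ∀ p q → p ≢ q → ∀ a b → Balanced 4 (λ y → (y p == a) ∧ (y q == b)) shuffles
    pairs (i , j) (i' , j') p≢q a b = trans (cong (4 *_) (trans (count≡∑ᴸ _ shuffles)
      (∑ᴸ-cong shuffles (λ y → 𝟙-∧ (y (i , j) == a) (y (i' , j') == b))))) (trans (by-rows (i ≟ᶠ i')) (sym length-shuffles))
      where
      by-rows : Dec (i ≡ i') → 4 * ∑[ y ← shuffles ] (𝟙 (y (i , j) == a) * 𝟙 (y (i' , j') == b)) ≡ length vs * r !
      by-rows (yes refl) = same-row i 4 (λ p → 𝟙 (p j == a) * 𝟙 (p j' == b)) (pair-moment j j' (p≢q ∘ cong (i ,_)) a b)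
      by-rows (no i≢i') = different-rows i i' i≢i' j a j' b (second-moment j a j' b)

  shuffles-count : ∀ (p : (Fin k → Bool) → Bool) c → (∀ v → ∑[ x < r ] 𝟙 (p (R v x)) ≡ c) →
    All (λ y → count (λ i → p (λ j → y (i , j))) (allFin r) ≡ c) shuffles
  shuffles-count p c rows-count = Allₚ.concat⁺ (Allₚ.map⁺ (All.universal (λ v → Allₚ.map⁺ (All.map
    (λ σ-preserves → trans (count≡∑ᴸ _ (allFin r)) (trans (∑ᴸ-allFin r _) (trans (σ-preserves _) (rows-count v))))
    (permutations-preserve-∑ r))) vs))

-- Uniformly random m × k matrices

module RandomMatrix (m k : ℕ) where

  matrices : List (Fin (m * k) → Bool)
  matrices = allPoints (m * k)

  N : ℕ
  N = length matrices

  entry : (Fin (m * k) → Bool) → Fin m → Fin k → Bool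
  entry v l j = v (combine l j)

  column-count : (Fin (m * k) → Bool) → Fin k → Bool → ℕ
  column-count v j a = ∑[ l < m ] 𝟙 (entry v l j == a)

  private
    cell : ∀ p a → 2 * ∑[ v ← matrices ] 𝟙 (v p == a) ≡ N
    cell p a = trans (cong (2 *_) (sym (count≡∑ᴸ _ matrices))) (allPoints-coordinates (m * k) p a)

    cell-pair : ∀ p q → p ≢ q → ∀ a b → 4 * ∑[ v ← matrices ] (𝟙 (v p == a) * 𝟙 (v q == b)) ≡ N
    cell-pair p q p≢q a b = trans (cong (4 *_) (trans (∑ᴸ-cong matrices (λ v → sym (𝟙-∧ (v p == a) (v q == b))))
      (sym (count≡∑ᴸ _ matrices)))) (allPoints-pairs (m * k) p q p≢q a b)

    cell-same : ∀ p a b → 4 * ∑[ v ← matrices ] (𝟙 (v p == a) * 𝟙 (v p == b)) ≡ 2 * (𝟙 (a == b) * N)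
    cell-same p a b = begin
        4 * ∑[ v ← matrices ] (𝟙 (v p == a) * 𝟙 (v p == b))
      ≡⟨ cong (4 *_) (∑ᴸ-𝟙-diag matrices (λ v → v p) a b) ⟩
        4 * (𝟙 (a == b) * ∑[ v ← matrices ] 𝟙 (v p == a))
      ≡⟨ regroup (𝟙 (a == b)) _ ⟩
        2 * (𝟙 (a == b) * (2 * ∑[ v ← matrices ] 𝟙 (v p == a)))
      ≡⟨ cong (λ z → 2 * (𝟙 (a == b) * z)) (cell p a) ⟩
        2 * (𝟙 (a == b) * N) ∎
      where
      open ≡-Reasoning
      regroup : ∀ x y → 4 * (x * y) ≡ 2 * (x * (2 * y))
      regroup = solve-∀

    combine-≢ʳ : ∀ {l l' : Fin m} {j j' : Fin k} → j ≢ j' → combine l j ≢ combine l' j'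
    combine-≢ʳ {l} {l'} {j} {j'} j≢j' e = j≢j' (proj₂ (Finₚ.combine-injective l j l' j' e))

    combine-≢ˡ : ∀ {l l' : Fin m} {j : Fin k} → l' ≢ l → combine l j ≢ combine l' j
    combine-≢ˡ {l} {l'} {j} l'≢l e = l'≢l (sym (proj₁ (Finₚ.combine-injective l j l' j e)))

    ∑ᴸ-column-count-product : ∀ j a j' b → ∑[ v ← matrices ] (column-count v j a * column-count v j' b)
      ≡ ∑[ l < m ] ∑[ l' < m ] ∑[ v ← matrices ] (𝟙 (entry v l j == a) * 𝟙 (entry v l' j' == b))
    ∑ᴸ-column-count-product j a j' b =
      trans (∑ᴸ-cong matrices (λ v → ∑-mul m (λ l → 𝟙 (entry v l j == a)) (λ l' → 𝟙 (entry v l' j' == b))))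
        (trans (∑ᴸ-∑-comm matrices m (λ v l → ∑[ l' < m ] (𝟙 (entry v l j == a) * 𝟙 (entry v l' j' == b))))
          (sum-cong-≗ {m} (λ l → ∑ᴸ-∑-comm matrices m (λ v l' → 𝟙 (entry v l j == a) * 𝟙 (entry v l' j' == b)))))

  ∑ᴸ-column-count : ∀ j a → 2 * ∑[ v ← matrices ] column-count v j a ≡ m * N
  ∑ᴸ-column-count j a = trans (cong (2 *_) (∑ᴸ-∑-comm matrices m (λ v l → 𝟙 (entry v l j == a))))
    (trans (*-distribˡ-sum 2 (λ l → ∑[ v ← matrices ] 𝟙 (entry v l j == a)))
      (trans (sum-cong-≗ {m} (λ l → cell (combine l j) a)) (∑-const m N)))

  ∑ᴸ-row-pair : ∀ j j' → j ≢ j' → ∀ a b → 4 * ∑[ v ← matrices ] ∑[ l < m ] (𝟙 (entry v l j == a) * 𝟙 (entry v l j' == b)) ≡ m * N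
  ∑ᴸ-row-pair j j' j≢j' a b = trans (cong (4 *_) (∑ᴸ-∑-comm matrices m G))
    (trans (*-distribˡ-sum 4 (λ l → ∑[ v ← matrices ] G v l))
      (trans (sum-cong-≗ {m} (λ l → cell-pair (combine l j) (combine l j') (combine-≢ʳ j≢j') a b)) (∑-const m N)))
    where
    G : (Fin (m * k) → Bool) → Fin m → ℕ
    G v l = 𝟙 (entry v l j == a) * 𝟙 (entry v l j' == b)

  ∑ᴸ-column-count-product-≢ : ∀ j j' → j ≢ j' → ∀ a b → 4 * ∑[ v ← matrices ] (column-count v j a * column-count v j' b) ≡ m * m * N
  ∑ᴸ-column-count-product-≢ j j' j≢j' a b = begin
      4 * ∑[ v ← matrices ] (column-count v j a * column-count v j' b)
    ≡⟨ cong (4 *_) (∑ᴸ-column-count-product j a j' b) ⟩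
      4 * ∑[ l < m ] ∑[ l' < m ] ∑[ v ← matrices ] (𝟙 (entry v l j == a) * 𝟙 (entry v l' j' == b))
    ≡⟨ *-distribˡ-sum 4 (λ l → ∑[ l' < m ] F l l') ⟩
      ∑[ l < m ] (4 * ∑[ l' < m ] F l l')
    ≡⟨ sum-cong-≗ {m} (λ l → trans (*-distribˡ-sum 4 (F l))
         (trans (sum-cong-≗ {m} (λ l' → cell-pair (combine l j) (combine l' j') (combine-≢ʳ j≢j') a b)) (∑-const m N))) ⟩
      ∑[ l < m ] (m * N)
    ≡⟨ trans (∑-const m (m * N)) (sym (*-assoc m m N)) ⟩
      m * m * N ∎
    where
    open ≡-Reasoning
    F : Fin m → Fin m → ℕ
    F l l' = ∑[ v ← matrices ] (𝟙 (entry v l j == a) * 𝟙 (entry v l' j' == b))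

  ∑ᴸ-column-count-product-≡ : ∀ j a b →
    4 * ∑[ v ← matrices ] (column-count v j a * column-count v j b) + m * N ≡ m * m * N + m * (2 * (𝟙 (a == b) * N))
  ∑ᴸ-column-count-product-≡ j a b = begin
      4 * ∑[ v ← matrices ] (column-count v j a * column-count v j b) + m * N
    ≡⟨ cong₂ _+_ (trans (cong (4 *_) (∑ᴸ-column-count-product j a j b)) (*-distribˡ-sum 4 Row)) (sym (∑-const m N)) ⟩
      ∑[ l < m ] (4 * Row l) + ∑[ l < m ] N
    ≡⟨ ∑-distrib-+ (λ l → 4 * Row l) (λ _ → N) ⟨
      ∑[ l < m ] (4 * Row l + N)
    ≡⟨ sum-cong-≗ {m} (λ l → ∑-all-but-one m l (F l) N (2 * (𝟙 (a == b) * N))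
         (λ l' l'≢l → cell-pair (combine l j) (combine l' j) (combine-≢ˡ l'≢l) a b) (cell-same (combine l j) a b)) ⟩
      ∑[ l < m ] (m * N + 2 * (𝟙 (a == b) * N))
    ≡⟨ ∑-const m _ ⟩
      m * (m * N + 2 * (𝟙 (a == b) * N))
    ≡⟨ distribute m N (2 * (𝟙 (a == b) * N)) ⟩
      m * m * N + m * (2 * (𝟙 (a == b) * N)) ∎
    where
    open ≡-Reasoning
    F : Fin m → Fin m → ℕ
    F l l' = ∑[ v ← matrices ] (𝟙 (entry v l j == a) * 𝟙 (entry v l' j == b))
    Row : Fin m → ℕ
    Row l = ∑[ l' < m ] F l l'
    distribute : ∀ m N e → m * (m * N + e) ≡ m * m * N + m * e
    distribute = solve-∀

-- The row multisets

module Construction {k : ℕ} (P : (Fin k → Bool) → Bool) (S : List (Fin k → Bool)) (S-uniform : PairwiseUniform S)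
  (D t A : ℕ)
  (excess : D + length S * count P (allPoints k) ≡ 2 ^ k * count P S)
  (fill : A + (D * t + length S * t * 2 ^ k) ≡ D * t * (D * t)) where

  m K s u f L r : ℕ
  m = length S
  K = 2 ^ k
  s = count P S
  u = count P (allPoints k)
  f = D * t
  L = m * (m * t * K) + A * m
  r = m * (f * f)

  padding : (Fin k → Bool) → List (Fin k → Bool)
  padding w = if P w then copies (m * t) (allPoints k) else copies (K * t) S

  filler : (Fin m → Fin k → Bool) → List (Fin k → Bool)
  filler W = concatMap (padding ∘ W) (allFin m) ++ copies A S

  repeated : (Fin m → Fin k → Bool) → List (Fin k → Bool)
  repeated W = concatMap (λ l → replicate f (W l)) (allFin m)

  rows : (Fin m → Fin k → Bool) → List (Fin k → Bool)
  rows W = repeated W ++ filler W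

  ∑ᴸ-repeated : ∀ W g → ∑ᴸ (repeated W) g ≡ f * ∑[ l < m ] g (W l)
  ∑ᴸ-repeated W g = trans (∑ᴸ-concatMap (λ l → replicate f (W l)) (allFin m) g)
    (trans (∑ᴸ-cong (allFin m) (λ l → ∑ᴸ-replicate f (W l) g)) (trans (∑ᴸ-allFin m _) (sym (*-distribˡ-sum f (g ∘ W)))))

  length-padding : ∀ w → length (padding w) ≡ m * t * K
  length-padding w with P w
  ... | true = trans (length-copies (m * t) (allPoints k)) (cong (m * t *_) (length-allPoints k))
  ... | false = trans (length-copies (K * t) S) (reorder K t m)
    where reorder : ∀ K t m → K * t * m ≡ m * t * K
          reorder = solve-∀

  length-filler : ∀ W → length (filler W) ≡ L
  length-filler W = begin
      length (filler W)
    ≡⟨ length-++ (concatMap (padding ∘ W) (allFin m)) ⟩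
      length (concatMap (padding ∘ W) (allFin m)) + length (copies A S)
    ≡⟨ cong₂ _+_ (trans (length≡∑ᴸ1 (concatMap (padding ∘ W) (allFin m))) (trans (∑ᴸ-concatMap (padding ∘ W) (allFin m) (λ _ → 1))
         (trans (∑ᴸ-cong (allFin m) (λ l → trans (sym (length≡∑ᴸ1 (padding (W l)))) (length-padding (W l))))
         (trans (∑ᴸ-const (allFin m) _) (cong (_* (m * t * K)) (length-tabulate {n = m} id))))))
         (length-copies A S) ⟩
      m * (m * t * K) + A * m ∎
    where open ≡-Reasoning

  m*f+L≡r : m * f + L ≡ r
  m*f+L≡r = trans (distribute m f t K A) (cong (m *_) (trans (+-comm (f + m * t * K) A) fill))
    where distribute : ∀ m f t K A → m * f + (m * (m * t * K) + A * m) ≡ m * (f + m * t * K + A)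
          distribute = solve-∀

  length-rows : ∀ W → length (rows W) ≡ r
  length-rows W = trans (length-++ (repeated W)) (trans (cong₂ _+_ repeated-length (length-filler W)) m*f+L≡r)
    where
    repeated-length : length (repeated W) ≡ m * f
    repeated-length = trans (length≡∑ᴸ1 (repeated W)) (trans (∑ᴸ-repeated W (λ _ → 1))
      (trans (cong (f *_) (trans (∑-const m 1) (*-identityʳ m))) (*-comm f m)))

  filler-pairwiseUniform : ∀ W → PairwiseUniform (filler W)
  filler-pairwiseUniform W = PairwiseUniform-++ (concatMap (padding ∘ W) (allFin m)) (copies A S)
    (PairwiseUniform-concatMap (padding ∘ W) (allFin m) (padding-uniform ∘ W)) (PairwiseUniform-copies A S S-uniform)
    where
    padding-uniform : ∀ w → PairwiseUniform (padding w)
    padding-uniform w with P w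
    ... | true = PairwiseUniform-copies (m * t) (allPoints k) (allPoints-pairwiseUniform k)
    ... | false = PairwiseUniform-copies (K * t) S S-uniform

  satisfied : ℕ
  satisfied = m * (t * (K * s)) + A * s

  satisfied+s*f : satisfied + s * f ≡ s * (f * f)
  satisfied+s*f = trans (regroup m t K s A f) (cong (s *_) fill)
    where regroup : ∀ m t K s A f → m * (t * (K * s)) + A * s + s * f ≡ s * (A + (f + m * t * K))
          regroup = solve-∀

  count-rows : ∀ W → count P (rows W) ≡ satisfied
  count-rows W = begin
      count P (rows W)
    ≡⟨ trans (count≡∑ᴸ P (rows W)) (∑ᴸ-++ (repeated W) (filler W) _) ⟩
      ∑ᴸ (repeated W) (𝟙 ∘ P) + ∑ᴸ (filler W) (𝟙 ∘ P)
    ≡⟨ cong₂ _+_ (trans (∑ᴸ-repeated W (𝟙 ∘ P)) (*-distribˡ-sum f (𝟙 ∘ P ∘ W)))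
         (trans (∑ᴸ-++ (concatMap (padding ∘ W) (allFin m)) (copies A S) _)
           (cong₂ _+_ (trans (∑ᴸ-concatMap (padding ∘ W) (allFin m) _) (∑ᴸ-allFin m _)) (∑ᴸ-copies A S _))) ⟩
      ∑[ l < m ] (f * 𝟙 (P (W l))) + (∑[ l < m ] ∑ᴸ (padding (W l)) (𝟙 ∘ P) + A * ∑ᴸ S (𝟙 ∘ P))
    ≡⟨ +-assoc (sum (λ l → f * 𝟙 (P (W l)))) _ _ ⟨
      ∑[ l < m ] (f * 𝟙 (P (W l))) + ∑[ l < m ] ∑ᴸ (padding (W l)) (𝟙 ∘ P) + A * ∑ᴸ S (𝟙 ∘ P)
    ≡⟨ cong₂ _+_ (trans (sym (∑-distrib-+ (λ l → f * 𝟙 (P (W l))) (λ l → ∑ᴸ (padding (W l)) (𝟙 ∘ P))))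
           (trans (sum-cong-≗ {m} (λ l → per-block (W l))) (∑-const m _)))
         (cong (A *_) (sym (count≡∑ᴸ P S))) ⟩
      m * (t * (K * s)) + A * s ∎
    where
    open ≡-Reasoning
    per-block : ∀ w → f * 𝟙 (P w) + ∑ᴸ (padding w) (𝟙 ∘ P) ≡ t * (K * s)
    per-block w with P w
    ... | true = begin
        f * 1 + ∑ᴸ (copies (m * t) (allPoints k)) (𝟙 ∘ P)
      ≡⟨ cong₂ _+_ (*-identityʳ f) (trans (∑ᴸ-copies (m * t) (allPoints k) _) (cong (m * t *_) (sym (count≡∑ᴸ P (allPoints k))))) ⟩
        D * t + m * t * u
      ≡⟨ factor D t m u ⟩
        t * (D + m * u)
      ≡⟨ cong (t *_) excess ⟩
        t * (K * s) ∎
      where factor : ∀ D t m u → D * t + m * t * u ≡ t * (D + m * u)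
            factor = solve-∀
    ... | false = trans (cong₂ _+_ (*-zeroʳ f) (trans (∑ᴸ-copies (K * t) S _) (cong (K * t *_) (sym (count≡∑ᴸ P S)))))
      (regroup K t s)
      where regroup : ∀ K t s → 0 + K * t * s ≡ t * (K * s)
            regroup = solve-∀

  rows-∑ᴸ : ∀ W c p → Balanced c p (filler W) → c * ∑[ x ← rows W ] 𝟙 (p x) ≡ c * f * ∑[ l < m ] 𝟙 (p (W l)) + L
  rows-∑ᴸ W c p balanced = begin
      c * ∑ᴸ (rows W) (𝟙 ∘ p)
    ≡⟨ cong (c *_) (trans (∑ᴸ-++ (repeated W) (filler W) _) (cong₂ _+_ (∑ᴸ-repeated W (𝟙 ∘ p)) (sym (count≡∑ᴸ p (filler W))))) ⟩
      c * (f * X + count p (filler W))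
    ≡⟨ *-distribˡ-+ c (f * X) _ ⟩
      c * (f * X) + c * count p (filler W)
    ≡⟨ cong₂ _+_ (sym (*-assoc c f X)) (trans balanced (length-filler W)) ⟩
      c * f * X + L ∎
    where
    open ≡-Reasoning
    X = ∑[ l < m ] 𝟙 (p (W l))

  open RandomMatrix m k

  R : (Fin (m * k) → Bool) → Fin r → Fin k → Bool
  R v x = lookup (rows (entry v)) (cast (sym (length-rows (entry v))) x)

  ∑-R : ∀ v g → ∑[ x < r ] g (R v x) ≡ ∑ᴸ (rows (entry v)) g
  ∑-R v g = trans (∑-cast (sym (length-rows (entry v))) (g ∘ lookup (rows (entry v)))) (∑ᴸ-lookup (rows (entry v)) g)

  open Symmetrization matrices r k R

  private
    averaged : ∀ c (p : (Fin k → Bool) → Bool) → (∀ W → Balanced c p (filler W)) →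
      c * ∑[ v ← matrices ] ∑[ l < m ] 𝟙 (p (entry v l)) ≡ m * N →
      c * ∑[ v ← matrices ] ∑[ x < r ] 𝟙 (p (R v x)) ≡ N * r
    averaged c p balanced entries = begin
        c * ∑[ v ← matrices ] ∑[ x < r ] 𝟙 (p (R v x))
      ≡⟨ *-distribˡ-∑ᴸ c matrices _ ⟩
        ∑[ v ← matrices ] (c * ∑[ x < r ] 𝟙 (p (R v x)))
      ≡⟨ ∑ᴸ-cong matrices (λ v → trans (cong (c *_) (∑-R v (𝟙 ∘ p))) (rows-∑ᴸ (entry v) c p (balanced (entry v)))) ⟩
        ∑[ v ← matrices ] (c * f * X v + L)
      ≡⟨ ∑ᴸ-distrib-+ matrices (λ v → c * f * X v) (λ _ → L) ⟩
        ∑[ v ← matrices ] (c * f * X v) + ∑[ v ← matrices ] L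
      ≡⟨ cong₂ _+_ (sym (*-distribˡ-∑ᴸ (c * f) matrices X)) (∑ᴸ-const matrices L) ⟩
        c * f * ∑[ v ← matrices ] X v + N * L
      ≡⟨ cong (_+ N * L) (trans (cong (_* sum-X) (*-comm c f)) (*-assoc f c sum-X)) ⟩
        f * (c * ∑[ v ← matrices ] X v) + N * L
      ≡⟨ cong (λ z → f * z + N * L) entries ⟩
        f * (m * N) + N * L
      ≡⟨ regroup f m N L ⟩
        N * (m * f + L)
      ≡⟨ cong (N *_) m*f+L≡r ⟩
        N * r ∎
      where
      open ≡-Reasoning
      X = λ v → ∑[ l < m ] 𝟙 (p (entry v l))
      sum-X = ∑[ v ← matrices ] X v
      regroup : ∀ f m N L → f * (m * N) + N * L ≡ N * (m * f + L)
      regroup = solve-∀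

    ∑𝟙∧≡∑𝟙*𝟙 : ∀ {n} (xs : List (Fin (m * k) → Bool)) (e : (Fin (m * k) → Bool) → Fin n → Fin k → Bool) j a j' b →
      ∑[ v ← xs ] ∑[ x < n ] 𝟙 ((e v x j == a) ∧ (e v x j' == b)) ≡ ∑[ v ← xs ] ∑[ x < n ] (𝟙 (e v x j == a) * 𝟙 (e v x j' == b))
    ∑𝟙∧≡∑𝟙*𝟙 xs e j a j' b = ∑ᴸ-cong xs (λ v → sum-cong-≗ (λ x → 𝟙-∧ (e v x j == a) (e v x j' == b)))

  first-moment : ∀ j a → 2 * ∑[ v ← matrices ] ones v j a ≡ N * r
  first-moment j a = averaged 2 (λ x → x j == a) (λ W → proj₁ (filler-pairwiseUniform W) j a) (∑ᴸ-column-count j a)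

  pair-moment : ∀ j j' → j ≢ j' → ∀ a b → 4 * ∑[ v ← matrices ] both v j a j' b ≡ N * r
  pair-moment j j' j≢j' a b = trans (cong (4 *_) (sym (∑𝟙∧≡∑𝟙*𝟙 matrices R j a j' b)))
    (averaged 4 (λ x → (x j == a) ∧ (x j' == b)) (λ W → proj₂ (filler-pairwiseUniform W) j j' j≢j' a b)
      (trans (cong (4 *_) (∑𝟙∧≡∑𝟙*𝟙 matrices entry j a j' b)) (∑ᴸ-row-pair j j' j≢j' a b)))

  private
    ones-rows : ∀ v j a → 2 * ones v j a ≡ 2 * f * column-count v j a + L
    ones-rows v j a = trans (cong (2 *_) (∑-R v _))
      (rows-∑ᴸ (entry v) 2 (λ x → x j == a) (proj₁ (filler-pairwiseUniform (entry v)) j a))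

    expand : ∀ j a j' b → 4 * ∑[ v ← matrices ] (ones v j a * ones v j' b)
      ≡ f * f * (4 * ∑[ v ← matrices ] (column-count v j a * column-count v j' b))
        + f * L * (2 * ∑[ v ← matrices ] column-count v j a) + f * L * (2 * ∑[ v ← matrices ] column-count v j' b) + N * (L * L)
    expand j a j' b = begin
        4 * ∑[ v ← matrices ] (ones v j a * ones v j' b)
      ≡⟨ *-distribˡ-∑ᴸ 4 matrices _ ⟩
        ∑[ v ← matrices ] (4 * (ones v j a * ones v j' b))
      ≡⟨ ∑ᴸ-cong matrices (λ v → trans (regroup₁ (ones v j a) (ones v j' b))
           (trans (cong₂ _*_ (ones-rows v j a) (ones-rows v j' b)) (regroup₂ f L (X v) (X' v)))) ⟩
        ∑[ v ← matrices ] (f * f * (4 * (X v * X' v)) + f * L * (2 * X v) + f * L * (2 * X' v) + L * L)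
      ≡⟨ trans (∑ᴸ-distrib-+ matrices _ _) (cong₂ _+_ (trans (∑ᴸ-distrib-+ matrices _ _) (cong₂ _+_
           (trans (∑ᴸ-distrib-+ matrices _ _) (cong₂ _+_ (scaled (f * f) 4 (λ v → X v * X' v)) (scaled (f * L) 2 X)))
           (scaled (f * L) 2 X'))) (∑ᴸ-const matrices (L * L))) ⟩
        f * f * (4 * ∑[ v ← matrices ] (X v * X' v)) + f * L * (2 * ∑[ v ← matrices ] X v)
          + f * L * (2 * ∑[ v ← matrices ] X' v) + N * (L * L) ∎
      where
      open ≡-Reasoning
      X = λ v → column-count v j a
      X' = λ v → column-count v j' b
      scaled : ∀ x y g → ∑[ v ← matrices ] (x * (y * g v)) ≡ x * (y * ∑[ v ← matrices ] g v)
      scaled x y g = trans (sym (*-distribˡ-∑ᴸ x matrices _)) (cong (x *_) (sym (*-distribˡ-∑ᴸ y matrices g)))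
      regroup₁ : ∀ x y → 4 * (x * y) ≡ (2 * x) * (2 * y)
      regroup₁ = solve-∀
      regroup₂ : ∀ f L x y → (2 * f * x + L) * (2 * f * y + L) ≡ f * f * (4 * (x * y)) + f * L * (2 * x) + f * L * (2 * y) + L * L
      regroup₂ = solve-∀

  second-moment-≢ : ∀ j j' → j ≢ j' → ∀ a b → SecondMoment j a j' b
  second-moment-≢ j j' j≢j' a b = begin
      4 * ∑[ v ← matrices ] (ones v j a * ones v j' b) + N * r
    ≡⟨ cong (_+ N * r) (trans (expand j a j' b) (cong₃ (λ x y z → f * f * x + f * L * y + f * L * z + N * (L * L))
         (∑ᴸ-column-count-product-≢ j j' j≢j' a b) (∑ᴸ-column-count j a) (∑ᴸ-column-count j' b))) ⟩
      f * f * (m * m * N) + f * L * (m * N) + f * L * (m * N) + N * (L * L) + N * r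
    ≡⟨ cong₂ _+_ (trans (square f m N L) (cong (λ z → N * (z * z)) m*f+L≡r)) (sym (pair-moment j j' j≢j' a b)) ⟩
      N * (r * r) + 4 * ∑[ v ← matrices ] both v j a j' b ∎
    where
    open ≡-Reasoning
    cong₃ : ∀ (h : ℕ → ℕ → ℕ → ℕ) {x x' y y' z z'} → x ≡ x' → y ≡ y' → z ≡ z' → h x y z ≡ h x' y' z'
    cong₃ h refl refl refl = refl
    square : ∀ f m N L → f * f * (m * m * N) + f * L * (m * N) + f * L * (m * N) + N * (L * L) ≡ N * ((m * f + L) * (m * f + L))
    square = solve-∀

  second-moment-≡ : ∀ j a b → SecondMoment j a j b
  second-moment-≡ j a b = begin
      4 * ∑[ v ← matrices ] (ones v j a * ones v j b) + N * r
    ≡⟨ cong (_+ N * r) (trans (expand j a j b) (cong₂ (λ y z → f * f * Q + f * L * y + f * L * z + N * (L * L))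
         (∑ᴸ-column-count j a) (∑ᴸ-column-count j b))) ⟩
      f * f * Q + f * L * (m * N) + f * L * (m * N) + N * (L * L) + N * (m * (f * f))
    ≡⟨ regroup₁ f Q L m N ⟩
      f * f * (Q + m * N) + f * L * (m * N) + f * L * (m * N) + N * (L * L)
    ≡⟨ cong (λ z → f * f * z + f * L * (m * N) + f * L * (m * N) + N * (L * L)) (∑ᴸ-column-count-product-≡ j a b) ⟩
      f * f * (m * m * N + m * (2 * (I * N))) + f * L * (m * N) + f * L * (m * N) + N * (L * L)
    ≡⟨ regroup₂ f m N L I ⟩
      N * ((m * f + L) * (m * f + L)) + 2 * I * (N * r)
    ≡⟨ cong₂ (λ x y → N * (x * x) + 2 * I * y) m*f+L≡r (sym (first-moment j a)) ⟩
      N * (r * r) + 2 * I * (2 * ∑[ v ← matrices ] ones v j a)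
    ≡⟨ cong (N * (r * r) +_) (trans (regroup₃ I _) (cong (4 *_) (trans (*-distribˡ-∑ᴸ I matrices _)
         (∑ᴸ-cong matrices (λ v → sym (∑-𝟙-diag r (λ x → R v x j) a b)))))) ⟩
      N * (r * r) + 4 * ∑[ v ← matrices ] both v j a j b ∎
    where
    open ≡-Reasoning
    Q = 4 * ∑[ v ← matrices ] (column-count v j a * column-count v j b)
    I = 𝟙 (a == b)
    regroup₁ : ∀ f Q L m N → f * f * Q + f * L * (m * N) + f * L * (m * N) + N * (L * L) + N * (m * (f * f))
      ≡ f * f * (Q + m * N) + f * L * (m * N) + f * L * (m * N) + N * (L * L)
    regroup₁ = solve-∀
    regroup₂ : ∀ f m N L I → f * f * (m * m * N + m * (2 * (I * N))) + f * L * (m * N) + f * L * (m * N) + N * (L * L)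
      ≡ N * ((m * f + L) * (m * f + L)) + 2 * I * (N * (m * (f * f)))
    regroup₂ = solve-∀
    regroup₃ : ∀ I x → 2 * I * (2 * x) ≡ 4 * (I * x)
    regroup₃ = solve-∀

  second-moment : ∀ j a j' b → SecondMoment j a j' b
  second-moment j a j' b = by-cases (j ≟ᶠ j')
    where
    by-cases : Dec (j ≡ j') → SecondMoment j a j' b
    by-cases (yes j≡j') = subst (λ j'' → SecondMoment j a j'' b) j≡j' (second-moment-≡ j a b)
    by-cases (no j≢j') = second-moment-≢ j j' j≢j' a b

  T : List (Fin r × Fin k → Bool)
  T = shuffles

  T-pairwiseUniform : PairwiseUniform T
  T-pairwiseUniform = shuffles-pairwiseUniform first-moment pair-moment second-moment

  T-count : All (λ y → count (λ i → P (λ j → y (i , j))) (allFin r) ≡ satisfied) T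
  T-count = shuffles-count P satisfied
    (λ v → trans (∑-R v (𝟙 ∘ P)) (trans (sym (count≡∑ᴸ P (rows (entry v)))) (count-rows (entry v))))

  length-T : length T ≡ N * r !
  length-T = length-shuffles

-- Rational arithmetic

module _ where

  open ℤ using (+_; +[1+_]; -[1+_]; +0)

  private
    toℚᵘ-frac : ∀ a p → Q.toℚᵘ (frac a (suc p)) U.≃ mkℚᵘ (+ a) p
    toℚᵘ-frac a p = Qₚ.toℚᵘ-fromℚᵘ (mkℚᵘ (+ a) p)

    +-* : ∀ x y → + (x ℕ.* y) ≡ + x ℤ.* + y
    +-* = ℤₚ.pos-*

  frac<frac⇒*< : ∀ u K s M → 1 ℕ.≤ K → 1 ℕ.≤ M → frac u K Q.< frac s M → u ℕ.* M ℕ.< s ℕ.* K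
  frac<frac⇒*< u (suc K) s (suc M) _ _ u/K<s/M
    with Uₚ.<-respˡ-≃ (toℚᵘ-frac u K) (Uₚ.<-respʳ-≃ (toℚᵘ-frac s M) (Qₚ.toℚᵘ-mono-< u/K<s/M))
  ... | *<* uM<sK = ℤₚ.drop‿+<+ (subst₂ ℤ._<_ (sym (+-* u (suc M))) (sym (+-* s (suc K))) uM<sK)

  frac≤ : ∀ s q (ε : ℚ) → 1 ℕ.≤ q → 0ℚ Q.< ε → s ℕ.* Q.↧ₙ ε ℕ.≤ q → frac s q Q.≤ ε
  frac≤ s (suc q) (mkℚ +[1+ n ] d-1 _) _ _ s*d≤q = Qₚ.toℚᵘ-cancel-≤ (Uₚ.≤-respˡ-≃ (Uₚ.≃-sym (toℚᵘ-frac s q))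
    (*≤* (subst₂ ℤ._≤_ (+-* s (suc d-1)) (+-* (suc n) (suc q)) (ℤ.+≤+ (≤-trans s*d≤q (m≤m+n (suc q) (n ℕ.* suc q)))))))
  frac≤ s (suc q) (mkℚ +0 _ _) _ 0<ε _ = ⊥-elim (ℤₚ.<-irrefl refl (ℤₚ.positive⁻¹ +0 {{Q.positive 0<ε}}))
  frac≤ s (suc q) (mkℚ -[1+ n ] _ _) _ 0<ε _ =
    ⊥-elim (ℤₚ.<-irrefl refl (ℤₚ.<-trans (ℤₚ.positive⁻¹ -[1+ n ] {{Q.positive 0<ε}}) ℤ.-<+))

  private
    cancel-added : ∀ A B Sp Sq C E → E ℤ.* (Sp ℤ.* Sq) ℤ.+ B ℤ.* Sp ℤ.* C ≡ A ℤ.* Sq ℤ.* C →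
      ((A ℤ.* Sq ℤ.+ ℤ.- B ℤ.* Sp) ℤ.* C) ℤ.* + 1 ≡ E ℤ.* (Sp ℤ.* Sq)
    cancel-added A B Sp Sq C E h = begin
        ((A ℤ.* Sq ℤ.+ ℤ.- B ℤ.* Sp) ℤ.* C) ℤ.* + 1
      ≡⟨ expand A B Sp Sq C ⟩
        A ℤ.* Sq ℤ.* C ℤ.- B ℤ.* Sp ℤ.* C
      ≡⟨ cong (ℤ._- B ℤ.* Sp ℤ.* C) h ⟨
        E ℤ.* (Sp ℤ.* Sq) ℤ.+ B ℤ.* Sp ℤ.* C ℤ.- B ℤ.* Sp ℤ.* C
      ≡⟨ cancel E Sp Sq B C ⟩
        E ℤ.* (Sp ℤ.* Sq) ∎
      where
      open ≡-Reasoning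
      expand : ∀ A B Sp Sq C → ((A ℤ.* Sq ℤ.+ ℤ.- B ℤ.* Sp) ℤ.* C) ℤ.* + 1 ≡ A ℤ.* Sq ℤ.* C ℤ.- B ℤ.* Sp ℤ.* C
      expand = ℤSolver.solve-∀
      cancel : ∀ E Sp Sq B C → E ℤ.* (Sp ℤ.* Sq) ℤ.+ B ℤ.* Sp ℤ.* C ℤ.- B ℤ.* Sp ℤ.* C ≡ E ℤ.* (Sp ℤ.* Sq)
      cancel = ℤSolver.solve-∀

  frac-sub-mul : ∀ a M b N c e → 1 ℕ.≤ M → 1 ℕ.≤ N → e ℕ.* (M ℕ.* N) ℕ.+ b ℕ.* M ℕ.* c ≡ a ℕ.* N ℕ.* c →
    frac e 1 ≡ (frac a M Q.- frac b N) Q.* frac c 1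
  frac-sub-mul a (suc p) b (suc q) c e _ _ h = Qₚ.toℚᵘ-injective (Uₚ.≃-trans (toℚᵘ-frac e 0) (Uₚ.≃-sym rhs))
    where
    open ≡-Reasoning
    lifted : + e ℤ.* (+ suc p ℤ.* + suc q) ℤ.+ + b ℤ.* + suc p ℤ.* + c ≡ + a ℤ.* + suc q ℤ.* + c
    lifted = begin
        + e ℤ.* (+ suc p ℤ.* + suc q) ℤ.+ + b ℤ.* + suc p ℤ.* + c
      ≡⟨ cong₂ ℤ._+_ (trans (cong (+ e ℤ.*_) (sym (+-* (suc p) (suc q)))) (sym (+-* e _)))
                     (trans (cong (ℤ._* + c) (sym (+-* b (suc p)))) (sym (+-* (b ℕ.* suc p) c))) ⟩
        + (e ℕ.* (suc p ℕ.* suc q)) ℤ.+ + (b ℕ.* suc p ℕ.* c)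
      ≡⟨ cong +_ h ⟩
        + (a ℕ.* suc q ℕ.* c)
      ≡⟨ trans (+-* (a ℕ.* suc q) c) (cong (ℤ._* + c) (+-* a (suc q))) ⟩
        + a ℤ.* + suc q ℤ.* + c ∎
    rhs : Q.toℚᵘ ((frac a (suc p) Q.- frac b (suc q)) Q.* frac c 1) U.≃ mkℚᵘ (+ e) 0
    rhs = Uₚ.≃-trans (Qₚ.toℚᵘ-homo-* (frac a (suc p) Q.- frac b (suc q)) (frac c 1))
      (Uₚ.≃-trans (Uₚ.*-cong (Uₚ.≃-trans (Qₚ.toℚᵘ-homo-+ (frac a (suc p)) (Q.- frac b (suc q)))
         (Uₚ.+-cong (toℚᵘ-frac a p) (Uₚ.≃-trans (Qₚ.toℚᵘ-homo‿- (frac b (suc q))) (Uₚ.-‿cong (toℚᵘ-frac b q))))) (toℚᵘ-frac c 0))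
      (*≡* (trans (cancel-added (+ a) (+ b) (+ suc p) (+ suc q) (+ c) (+ e) lifted)
        (cong (+ e ℤ.*_) (trans (sym (+-* (suc p) (suc q))) (cong +_ (sym (*-identityʳ _))))))))

-- Choice of parameters

record Scale (D n d : ℕ) : Set where
  field
    t : ℕ
    covers : D + n ≤ D * (D * t)
    d≤D*t : d ≤ D * t
    D*t≤ : D * t ≤ d * (D + n)

-- t₀ = ⌊n / D⌋ + 1 is the least multiplier with D t₀ > n, hence also D t₀ ≤ D + n.
scale : ∀ D n d → 1 ≤ D → 1 ≤ d → Scale D n d
scale D@(suc _) n d@(suc _) _ _ = record { t = d * t₀ ; covers = covers ; d≤D*t = d≤D*t ; D*t≤ = D*t≤ }
  where
  t₀ = suc (n / D)
  D*t₀≡ : D * t₀ ≡ D + n / D * D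
  D*t₀≡ = trans (*-suc D (n / D)) (cong (D +_) (*-comm D (n / D)))
  n<D*t₀ : n ℕ.< D * t₀
  n<D*t₀ = subst₂ ℕ._<_ (sym (m≡m%n+[m/n]*n n D)) (sym D*t₀≡) (+-monoˡ-< (n / D * D) (m%n<n n D))
  D*t₀≤D+n : D * t₀ ≤ D + n
  D*t₀≤D+n = subst (_≤ D + n) (sym D*t₀≡)
    (+-monoʳ-≤ D (subst (n / D * D ≤_) (sym (m≡m%n+[m/n]*n n D)) (m≤n+m _ (n % D))))
  covers : D + n ≤ D * (D * (d * t₀))
  covers = begin
      D + n
    ≤⟨ +-monoʳ-≤ D (m≤n*m n D) ⟩
      D + D * n
    ≡⟨ *-suc D n ⟨
      D * suc n
    ≤⟨ *-monoʳ-≤ D n<D*t₀ ⟩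
      D * (D * t₀)
    ≤⟨ *-monoʳ-≤ D (*-monoʳ-≤ D (m≤n*m t₀ d)) ⟩
      D * (D * (d * t₀)) ∎
    where open ≤-Reasoning
  d≤D*t : d ≤ D * (d * t₀)
  d≤D*t = ≤-trans (m≤m*n d t₀) (m≤n*m (d * t₀) D)
  D*t≤ : D * (d * t₀) ≤ d * (D + n)
  D*t≤ = subst (_≤ d * (D + n)) (x*[y*z]≡y*[x*z] d D t₀) (*-monoʳ-≤ d D*t₀≤D+n)

size-constant : ℕ → ℚ → ℕ
size-constant k ε = 4 * (Q.↧ₙ ε * Q.↧ₙ ε) * (2 ^ k * 2 ^ k)

module ParameterChoice {k : ℕ} (ε : ℚ) (0<ε : 0ℚ < ε) (P : (Fin k → Bool) → Bool) (S : List (Fin k → Bool))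
  (m≥1 : length S ≥ 1) (S-uniform : PairwiseUniform S)
  (α<β : frac (count P (allPoints k)) (2 ^ k) < frac (count P S) (length S)) where

  private
    m K s u d : ℕ
    m = length S
    K = 2 ^ k
    s = count P S
    u = count P (allPoints k)
    d = Q.↧ₙ ε

  m*u<K*s : m * u ℕ.< K * s
  m*u<K*s = subst₂ ℕ._<_ (*-comm u m) (*-comm s K) (frac<frac⇒*< u K s m (m^n>0 2 k) m≥1 α<β)

  D : ℕ
  D = K * s ∸ m * u

  excess : D + m * u ≡ K * s
  excess = m∸n+n≡m (<⇒≤ m*u<K*s)

  D≤m*K : D ≤ m * K
  D≤m*K = ≤-trans (m≤m+n D (m * u))
    (subst (_≤ m * K) (sym excess) (subst (K * s ≤_) (*-comm K m) (*-monoʳ-≤ K (count≤length P S))))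

  open Scale (scale D (m * K) d (m<n⇒0<n∸m m*u<K*s) (s≤s z≤n))

  f : ℕ
  f = D * t

  f+m*t*K≤f*f : f + m * t * K ≤ f * f
  f+m*t*K≤f*f = begin
      D * t + m * t * K
    ≡⟨ factor D t m K ⟩
      (D + m * K) * t
    ≤⟨ *-monoˡ-≤ t covers ⟩
      D * (D * t) * t
    ≡⟨ reassoc D t ⟩
      D * t * (D * t) ∎
    where
    open ≤-Reasoning
    factor : ∀ D t m K → D * t + m * t * K ≡ (D + m * K) * t
    factor = solve-∀
    reassoc : ∀ D t → D * (D * t) * t ≡ D * t * (D * t)
    reassoc = solve-∀

  A : ℕ
  A = f * f ∸ (f + m * t * K)

  open Construction P S S-uniform D t A excess (m∸n+n≡m f+m*t*K≤f*f) public
    using (r; T; T-pairwiseUniform; T-count; length-T; satisfied; satisfied+s*f)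

  f≥1 : 1 ≤ f
  f≥1 = ≤-trans (s≤s z≤n) d≤D*t

  r≥1 : r ≥ 1
  r≥1 = *-mono-≤ m≥1 (*-mono-≤ f≥1 f≥1)

  r≤ : r ≤ size-constant k ε * m ^ 3
  r≤ = begin
      m * (f * f)
    ≤⟨ *-monoʳ-≤ m (*-mono-≤ f≤ f≤) ⟩
      m * (d * (m * K + m * K) * (d * (m * K + m * K)))
    ≡⟨ regroup m d K ⟩
      4 * (d * d) * (K * K) * m ^ 3 ∎
    where
    open ≤-Reasoning
    f≤ : f ≤ d * (m * K + m * K)
    f≤ = ≤-trans D*t≤ (*-monoʳ-≤ d (+-monoˡ-≤ (m * K) D≤m*K))
    regroup : ∀ m d K → m * (d * (m * K + m * K) * (d * (m * K + m * K))) ≡ 4 * (d * d) * (K * K) * (m * (m * (m * 1)))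
    regroup = solve-∀

  ε~ : ℚ
  ε~ = frac s (m * f)

  ε~≤ε : ε~ Q.≤ ε
  ε~≤ε = frac≤ s (m * f) ε (*-mono-≤ m≥1 f≥1) 0<ε (*-mono-≤ (count≤length P S) d≤D*t)

  length-T≥1 : length T ≥ 1
  length-T≥1 = subst (1 ≤_) (sym length-T) (*-mono-≤ (subst (1 ≤_) (sym (length-allPoints (m * k))) (m^n>0 2 (m * k))) (1≤n! r))

  T-frequency : All (λ y → frac (count (λ i → P (λ j → y (i , j))) (allFin r)) 1 ≡ (frac s m - ε~) Q.* frac r 1) T
  T-frequency = All.map (λ count≡ → trans (cong (λ c → frac c 1) count≡) frequency) T-count
    where
    frequency : frac satisfied 1 ≡ (frac s m - ε~) Q.* frac r 1
    frequency = frac-sub-mul s m s (m * f) r satisfied m≥1 (*-mono-≤ m≥1 f≥1)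
      (trans (factor satisfied m f s) (trans (cong (m * (m * f) *_) satisfied+s*f) (regroup m f s)))
      where
      factor : ∀ c m f s → c * (m * (m * f)) + s * m * (m * (f * f)) ≡ m * (m * f) * (c + s * f)
      factor = solve-∀
      regroup : ∀ m f s → m * (m * f) * (s * (f * f)) ≡ s * (m * f) * (m * (f * f))
      regroup = solve-∀

theorem7 : (k : ℕ) (ε : ℚ) → 0ℚ < ε →
    Σ ℕ λ C →
    (P : (Fin k → Bool) → Bool) (S : List (Fin k → Bool)) →
    length S ≥ 1 →
    PairwiseUniform S →
    frac (count P (allPoints k)) (2 ^ k) < frac (count P S) (length S) →
    Σ ℕ λ r → Σ ℚ λ ε~ → Σ (List (Fin r × Fin k → Bool)) λ T →
      (r ≥ 1) × (r ≤ C * length S ^ 3) × (ε~ Q.≤ ε)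
      × (length T ≥ 1) × PairwiseUniform T
      × All (λ y → frac (count (λ i → P (λ j → y (i , j))) (allFin r)) 1
                   ≡ (frac (count P S) (length S) - ε~) Q.* frac r 1) T
theorem7 k ε 0<ε = size-constant k ε , λ P S m≥1 S-uniform α<β →
  let open ParameterChoice ε 0<ε P S m≥1 S-uniform α<β
  in r , ε~ , T , r≥1 , r≤ , ε~≤ε , length-T≥1 , T-pairwiseUniform , T-frequency
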